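{- Suppose that $N$ is an odd number which is either perfect or abundant (i.e. $\sigma(N)\geq 2N$). Let $p_3$ be the third smallest prime divisor of $N$ and let $k$ be the number of distinct prime divisors of $N$. Then $k \geq b_{\frac{16}{15}}(p_3) +2$.
   Context: $\sigma(N)$ is the sum of the positive divisors of $N$. Let $P_j$ denote the $j$-th prime number. For a prime $P_j$ and a real number $\alpha>1$, $b_\alpha(P_j)$ is the smallest positive integer $b$ such that $$\alpha < \prod_{i=0}^{b-1}\frac{P_{j+i}}{P_{j+i}-1}.$$ -}

module Defs where

open import Data.Nat using (ℕ; zero; suc; _+_; _*_; _∸_; _≤_; _<_; _!)
open import Data.Nat.Divisibility using (_∣_; _∣?_)
open import Data.Nat.Primality using (Prime; prime?)
open import Data.List using (List; filter; length; applyUpTo; upTo; foldr; map)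
open import Data.Nat.ListAction using (sum)
open import Data.Integer using (+_)
open import Data.Rational.Unnormalised as Q using (ℚᵘ; mkℚᵘ; 1ℚᵘ)
open import Data.Product using (_×_)
open import Relation.Nullary using (¬_; does)
open import Relation.Nullary.Decidable using (_×-dec_)
open import Relation.Binary.PropositionalEquality using (_≡_)
open import Data.Bool using (if_then_else_)

σ : ℕ → ℕ
σ N = sum (filter (_∣? N) (applyUpTo suc N))

primeDivisorsBelow : ℕ → ℕ → List ℕ
primeDivisorsBelow N m = filter (λ p → prime? p ×-dec p ∣? N) (upTo m)

-- number of distinct prime divisors of N (for N ≥ 1 all are ≤ N)
ω : ℕ → ℕ
ω N = length (primeDivisorsBelow N (suc N))

IsThirdPrimeDivisor : ℕ → ℕ → Set
IsThirdPrimeDivisor N p = Prime p × p ∣ N × length (primeDivisorsBelow N p) ≡ 2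

-- first prime among c, c+1, ..., c+fuel-1 (returns c+fuel if none)
searchPrime : ℕ → ℕ → ℕ
searchPrime zero c = c
searchPrime (suc f) c = if does (prime? c) then c else searchPrime f (suc c)

-- smallest prime > p  (by Euclid there is one in p+1 .. p!+1)
nextPrime : ℕ → ℕ
nextPrime p = searchPrime (p ! + 1) (suc p)

-- P j : the j-th prime, 0-indexed here (P 0 = 2, P 1 = 3, P 2 = 5, ...)
P : ℕ → ℕ
P zero = 2
P (suc j) = nextPrime (P j)

-- the rational q / (q - 1) for q ≥ 2  (mkℚᵘ n d denotes n / (d + 1))
ratio : ℕ → ℚᵘ
ratio q = mkℚᵘ (+ q) (q ∸ 2)

prodRatio : ℕ → ℕ → ℚᵘ
prodRatio j b = foldr Q._*_ 1ℚᵘ (map (λ i → ratio (P (j + i))) (upTo b))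

IsB : ℚᵘ → ℕ → ℕ → Set
IsB α j b = 1 ≤ b × α Q.< prodRatio j b × (∀ b′ → 1 ≤ b′ → b′ < b → ¬ (α Q.< prodRatio j b′))

{-# OPTIONS --safe #-}
module Submission where

-- Splitting the divisors of p^(a+1)·m (p ∤ m) according to divisibility by p gives
-- σ(p^(a+1)·m) = p·σ(p^a·m) + σ(m), hence (p-1)·σ(p^a·m) ≤ p^(a+1)·σ(m); by induction over the
-- prime divisors, σ(N)/N ≤ ∏_{p ∣ N} p/(p-1), so an abundant N has 2 ≤ ∏_{p ∣ N} p/(p-1).
-- The two smallest prime divisors of an odd N are at least 3 and 5 and contribute at most
-- 3/2 · 5/4 = 15/8, so the remaining k-2 primes, all at least p₃ = P_j, contribute at least
-- 16/15, strictly because 16·∏(p-1) is even while 15·∏p is odd. Since x/(x-1) decreases, the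
-- i-th of these primes may be replaced by P_{j+i}, giving 16/15 < ∏_{i<k-2} P_{j+i}/(P_{j+i}-1),
-- whence b ≤ k-2 by minimality of b.

open import Defs
open import Data.Bool using (true; false; if_then_else_)
open import Data.Integer as ℤ using (+_; +<+)
open import Data.Integer.Properties using (pos-*)
open import Data.List using (List; []; _∷_; _++_; filter; applyUpTo; upTo; map; foldr; length)
open import Data.List.Membership.Propositional using (_∈_)
open import Data.List.Membership.Propositional.Properties using (∈-filter⁺; ∈-upTo⁺)
open import Data.List.Properties using (map-++; map-∘; map-cong; map-applyUpTo; filter-++; length-++)
open import Data.List.Relation.Unary.All as All using (All; []; _∷_)
open import Data.List.Relation.Unary.All.Properties using (all-filter; map⁺)
open import Data.List.Relation.Unary.Any using (here; there)
open import Data.List.Relation.Unary.Any.Properties using (¬Any[])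
open import Data.Nat
open import Data.Nat.Coprimality using (Coprime; coprime-divisor)
open import Data.Nat.Divisibility
open import Data.Nat.Induction using (<-rec)
open import Data.Nat.ListAction using (sum; product)
open import Data.Nat.ListAction.Properties using (sum-++; product≢0)
open import Data.Nat.Primality using (Prime; prime?; prime⇒irreducible; prime⇒nonZero; euclidsLemma; prime[2])
open import Data.Nat.Primality.Factorisation using (factorise)
open import Data.Nat.Properties
open import Data.Nat.Tactic.RingSolver using (solve-∀)
open import Data.Product using (_×_; _,_; proj₁; proj₂; ∃-syntax)
open import Data.Rational.Unnormalised as Q using (ℚᵘ; mkℚᵘ; 1ℚᵘ; *<*)
open import Data.Sum using (inj₁; inj₂; [_,_]′)
open import Function using (id; _∘_)
open import Relation.Nullary using (yes; no; does; ¬_)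
open import Relation.Nullary.Decidable using (dec-true; dec-false; from-no; _×-dec_)
open import Relation.Nullary.Negation using (contradiction)
open import Relation.Unary using (Decidable)
open import Relation.Binary.PropositionalEquality
import Algebra.Properties.CommutativeSemigroup as CommutativeSemigroupProperties

private
  module +-CS = CommutativeSemigroupProperties +-commutativeSemigroup
  module *-CS = CommutativeSemigroupProperties *-commutativeSemigroup

range : ℕ → ℕ → List ℕ
range c zero    = []
range c (suc n) = c ∷ range (suc c) n

applyUpTo-range : ∀ (f : ℕ → ℕ) c n → (∀ i → f i ≡ c + i) → applyUpTo f n ≡ range c n
applyUpTo-range f c zero    f≡c+ = refl
applyUpTo-range f c (suc n) f≡c+ =
  cong₂ _∷_ (trans (f≡c+ 0) (+-identityʳ c))
            (applyUpTo-range (f ∘ suc) (suc c) n (λ i → trans (f≡c+ (suc i)) (+-suc c i)))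

upTo≡range : ∀ n → upTo n ≡ range 0 n
upTo≡range n = applyUpTo-range id 0 n (λ _ → refl)

range-++ : ∀ c m n → range c (m + n) ≡ range c m ++ range (c + m) n
range-++ c zero    n = cong (λ c′ → range c′ n) (sym (+-identityʳ c))
range-++ c (suc m) n = cong (c ∷_) (begin
    range (suc c) (m + n)                 ≡⟨ range-++ (suc c) m n ⟩
    range (suc c) m ++ range (suc c + m) n ≡⟨ cong (λ c′ → range (suc c) m ++ range c′ n) (sym (+-suc c m)) ⟩
    range (suc c) m ++ range (c + suc m) n ∎)
  where open ≡-Reasoning

sum-filter : ∀ {P : ℕ → Set} (P? : Decidable P) xs →
             sum (filter P? xs) ≡ sum (map (λ x → if does (P? x) then x else 0) xs)
sum-filter P? []       = refl
sum-filter P? (x ∷ xs) with does (P? x)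
... | true  = cong (_+_ x) (sum-filter P? xs)
... | false = sum-filter P? xs

sum-map-+ : ∀ (f g : ℕ → ℕ) xs → sum (map (λ x → f x + g x) xs) ≡ sum (map f xs) + sum (map g xs)
sum-map-+ f g []       = refl
sum-map-+ f g (x ∷ xs) =
  trans (cong (_+_ (f x + g x)) (sum-map-+ f g xs)) (+-CS.interchange (f x) (g x) _ _)

sum-map-* : ∀ k (f : ℕ → ℕ) xs → sum (map (λ x → k * f x) xs) ≡ k * sum (map f xs)
sum-map-* k f []       = sym (*-zeroʳ k)
sum-map-* k f (x ∷ xs) =
  trans (cong (_+_ (k * f x)) (sum-map-* k f xs)) (sym (*-distribˡ-+ k (f x) _))

sum-map-range-++ : ∀ (f : ℕ → ℕ) c m n →
  sum (map f (range c (m + n))) ≡ sum (map f (range c m)) + sum (map f (range (c + m) n))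
sum-map-range-++ f c m n =
  trans (cong (sum ∘ map f) (range-++ c m n)) (trans (cong sum (map-++ f (range c m) _)) (sum-++ (map f (range c m)) _))

sum-map-range-zero : ∀ (f : ℕ → ℕ) c n → (∀ i → i < n → f (c + i) ≡ 0) → sum (map f (range c n)) ≡ 0
sum-map-range-zero f c zero    _   = refl
sum-map-range-zero f c (suc n) f≡0 = cong₂ _+_
  (trans (cong f (sym (+-identityʳ c))) (f≡0 0 z<s))
  (sum-map-range-zero f (suc c) n (λ i i<n → trans (cong f (sym (+-suc c i))) (f≡0 (suc i) (s<s i<n))))

-- The divisor sum

divisorTerm : ℕ → ℕ → ℕ
divisorTerm N d = if does (d ∣? N) then d else 0

divisorTerm-∣ : ∀ {N d} → d ∣ N → divisorTerm N d ≡ d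
divisorTerm-∣ {N} {d} d∣N = cong (if_then d else 0) (dec-true (d ∣? N) d∣N)

divisorTerm-∤ : ∀ {N d} → d ∤ N → divisorTerm N d ≡ 0
divisorTerm-∤ {N} {d} d∤N = cong (if_then d else 0) (dec-false (d ∣? N) d∤N)

σ≡sum-divisorTerm : ∀ N → σ N ≡ sum (map (divisorTerm N) (range 1 N))
σ≡sum-divisorTerm N =
  trans (cong (sum ∘ filter (_∣? N)) (applyUpTo-range suc 1 N (λ _ → refl)))
        (sum-filter (_∣? N) (range 1 N))

sum-divisorTerm-beyond : ∀ m .{{_ : NonZero m}} k → sum (map (divisorTerm m) (range 1 (m + k))) ≡ σ m
sum-divisorTerm-beyond m k = begin
    sum (map (divisorTerm m) (range 1 (m + k)))
  ≡⟨ sum-map-range-++ (divisorTerm m) 1 m k ⟩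
    sum (map (divisorTerm m) (range 1 m)) + sum (map (divisorTerm m) (range (suc m) k))
  ≡⟨ cong₂ _+_ (sym (σ≡sum-divisorTerm m)) (sum-map-range-zero (divisorTerm m) (suc m) k too-large) ⟩
    σ m + 0
  ≡⟨ +-identityʳ (σ m) ⟩
    σ m
  ∎
  where
  open ≡-Reasoning
  too-large : ∀ i → i < k → divisorTerm m (suc m + i) ≡ 0
  too-large i _ = divisorTerm-∤ (λ d∣m → <⇒≱ (s≤s (m≤m+n m i)) (∣⇒≤ d∣m))

onMultiplesOf offMultiplesOf : ℕ → (ℕ → ℕ) → ℕ → ℕ
onMultiplesOf  p h d = if does (p ∣? d) then h d else 0
offMultiplesOf p h d = if does (p ∣? d) then 0 else h d

onMultiplesOf+offMultiplesOf : ∀ p h d → onMultiplesOf p h d + offMultiplesOf p h d ≡ h d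
onMultiplesOf+offMultiplesOf p h d with does (p ∣? d)
... | true  = +-identityʳ (h d)
... | false = refl

onMultiplesOf-∣ : ∀ {p d} h → p ∣ d → onMultiplesOf p h d ≡ h d
onMultiplesOf-∣ {p} {d} h p∣d = cong (if_then h d else 0) (dec-true (p ∣? d) p∣d)

onMultiplesOf-∤ : ∀ {p d} h → p ∤ d → onMultiplesOf p h d ≡ 0
onMultiplesOf-∤ {p} {d} h p∤d = cong (if_then h d else 0) (dec-false (p ∣? d) p∤d)

∤-between-multiples : ∀ p t {r} → 0 < r → r < p → p ∤ p * t + r
∤-between-multiples p t {suc r} _ r<p p∣ = <⇒≱ r<p (∣⇒≤ (∣m+n∣m⇒∣n p∣ (m∣m*n t)))

sum-onMultiplesOf-block : ∀ p .{{_ : NonZero p}} h t →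
  sum (map (onMultiplesOf p h) (range (suc (p * t)) p)) ≡ h (p * suc t)
sum-onMultiplesOf-block p@(suc q) h t = begin
    sum (map g (range c p))
  ≡⟨ cong (sum ∘ map g ∘ range c) (+-comm 1 q) ⟩
    sum (map g (range c (q + 1)))
  ≡⟨ sum-map-range-++ g c q 1 ⟩
    sum (map g (range c q)) + (g (c + q) + 0)
  ≡⟨ cong₂ _+_ (sum-map-range-zero g c q below-last) (+-identityʳ (g (c + q))) ⟩
    g (c + q)
  ≡⟨ cong g c+q≡p*[1+t] ⟩
    g (p * suc t)
  ≡⟨ onMultiplesOf-∣ h (m∣m*n {p} (suc t)) ⟩
    h (p * suc t)
  ∎
  where
  open ≡-Reasoning
  g = onMultiplesOf p h
  c = suc (p * t)
  below-last : ∀ i → i < q → g (c + i) ≡ 0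
  below-last i i<q = onMultiplesOf-∤ h
    (subst (p ∤_) (+-suc (p * t) i) (∤-between-multiples p t z<s (s<s i<q)))
  c+q≡p*[1+t] : c + q ≡ p * suc t
  c+q≡p*[1+t] = trans (cong suc (+-comm (p * t) q)) (sym (*-suc p t))

sum-onMultiplesOf : ∀ p .{{_ : NonZero p}} h M t →
  sum (map (onMultiplesOf p h) (range (suc (p * t)) (p * M))) ≡ sum (map (h ∘ (p *_)) (range (suc t) M))
sum-onMultiplesOf p h zero    t = cong (sum ∘ map (onMultiplesOf p h) ∘ range (suc (p * t))) (*-zeroʳ p)
sum-onMultiplesOf p h (suc M) t = begin
    sum (map g (range c (p * suc M)))
  ≡⟨ cong (sum ∘ map g ∘ range c) (*-suc p M) ⟩
    sum (map g (range c (p + p * M)))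
  ≡⟨ sum-map-range-++ g c p (p * M) ⟩
    sum (map g (range c p)) + sum (map g (range (c + p) (p * M)))
  ≡⟨ cong₂ _+_ (sum-onMultiplesOf-block p h t)
               (trans (cong (λ c′ → sum (map g (range c′ (p * M)))) c+p≡1+p*[1+t])
                      (sum-onMultiplesOf p h M (suc t))) ⟩
    h (p * suc t) + sum (map (h ∘ (p *_)) (range (suc (suc t)) M))
  ∎
  where
  open ≡-Reasoning
  g = onMultiplesOf p h
  c = suc (p * t)
  c+p≡1+p*[1+t] : c + p ≡ suc (p * suc t)
  c+p≡1+p*[1+t] = cong suc (trans (+-comm (p * t) p) (sym (*-suc p t)))

divisorTerm-* : ∀ p .{{_ : NonZero p}} M e → divisorTerm (p * M) (p * e) ≡ p * divisorTerm M e
divisorTerm-* p M e with e ∣? M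
... | yes e∣M = divisorTerm-∣ (*-monoʳ-∣ p e∣M)
... | no  e∤M = trans (divisorTerm-∤ (e∤M ∘ *-cancelˡ-∣ p)) (sym (*-zeroʳ p))

prime∤⇒coprime : ∀ {p d} → Prime p → p ∤ d → Coprime d p
prime∤⇒coprime pr p∤d {i} (i∣d , i∣p) with prime⇒irreducible pr i∣p
... | inj₁ i≡1 = i≡1
... | inj₂ refl = contradiction i∣d p∤d

∣p^k*m⇒∣m : ∀ {p d m} → Prime p → p ∤ d → ∀ k → d ∣ p ^ k * m → d ∣ m
∣p^k*m⇒∣m {d = d} {m} pr p∤d zero    d∣ = subst (d ∣_) (*-identityˡ m) d∣
∣p^k*m⇒∣m {p} {d} {m} pr p∤d (suc k) d∣ = ∣p^k*m⇒∣m pr p∤d k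
  (coprime-divisor (prime∤⇒coprime pr p∤d) (subst (d ∣_) (*-assoc p (p ^ k) m) d∣))

offMultiplesOf-divisorTerm : ∀ {p m} → Prime p → p ∤ m → ∀ k d →
  offMultiplesOf p (divisorTerm (p ^ k * m)) d ≡ divisorTerm m d
offMultiplesOf-divisorTerm {p} {m} pr p∤m k d with p ∣? d
... | yes p∣d = sym (divisorTerm-∤ (p∤m ∘ ∣-trans p∣d))
... | no  p∤d with d ∣? m
...   | yes d∣m = divisorTerm-∣ (∣-trans d∣m (n∣m*n (p ^ k)))
...   | no  d∤m = divisorTerm-∤ (d∤m ∘ ∣p^k*m⇒∣m pr p∤d k)

σ[p*p^a*m]≡p*σ[p^a*m]+σ[m] : ∀ {p} a {m} → Prime p → p ∤ m → .{{_ : NonZero m}} →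
  σ (p * (p ^ a * m)) ≡ p * σ (p ^ a * m) + σ m
σ[p*p^a*m]≡p*σ[p^a*m]+σ[m] {p} a {m} pr p∤m = begin
    σ N
  ≡⟨ σ≡sum-divisorTerm N ⟩
    sum (map (divisorTerm N) (range 1 N))
  ≡⟨ cong sum (map-cong (sym ∘ onMultiplesOf+offMultiplesOf p (divisorTerm N)) (range 1 N)) ⟩
    sum (map (λ d → onMultiplesOf p (divisorTerm N) d + offMultiplesOf p (divisorTerm N) d) (range 1 N))
  ≡⟨ sum-map-+ (onMultiplesOf p (divisorTerm N)) (offMultiplesOf p (divisorTerm N)) (range 1 N) ⟩
    sum (map (onMultiplesOf p (divisorTerm N)) (range 1 N)) + sum (map (offMultiplesOf p (divisorTerm N)) (range 1 N))
  ≡⟨ cong₂ _+_ multiples non-multiples ⟩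
    p * σ M + σ m
  ∎
  where
  open ≡-Reasoning
  instance
    p≢0 : NonZero p
    p≢0 = prime⇒nonZero pr
  M = p ^ a * m
  N = p * M
  N≡p^[1+a]*m : N ≡ p ^ suc a * m
  N≡p^[1+a]*m = sym (*-assoc p (p ^ a) m)
  multiples : sum (map (onMultiplesOf p (divisorTerm N)) (range 1 N)) ≡ p * σ M
  multiples = begin
      sum (map (onMultiplesOf p (divisorTerm N)) (range 1 N))
    ≡⟨ cong (λ c → sum (map (onMultiplesOf p (divisorTerm N)) (range (suc c) N))) (sym (*-zeroʳ p)) ⟩
      sum (map (onMultiplesOf p (divisorTerm N)) (range (suc (p * 0)) N))
    ≡⟨ sum-onMultiplesOf p (divisorTerm N) M 0 ⟩
      sum (map (divisorTerm N ∘ (p *_)) (range 1 M))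
    ≡⟨ cong sum (map-cong (divisorTerm-* p M) (range 1 M)) ⟩
      sum (map (λ e → p * divisorTerm M e) (range 1 M))
    ≡⟨ sum-map-* p (divisorTerm M) (range 1 M) ⟩
      p * sum (map (divisorTerm M) (range 1 M))
    ≡⟨ cong (p *_) (sym (σ≡sum-divisorTerm M)) ⟩
      p * σ M
    ∎
  m≤N : m ≤ N
  m≤N = subst (m ≤_) (sym N≡p^[1+a]*m) (m≤n*m m (p ^ suc a) {{m^n≢0 p (suc a)}})
  non-multiples : sum (map (offMultiplesOf p (divisorTerm N)) (range 1 N)) ≡ σ m
  non-multiples = begin
      sum (map (offMultiplesOf p (divisorTerm N)) (range 1 N))
    ≡⟨ cong sum (map-cong (λ d → trans (cong (λ n → offMultiplesOf p (divisorTerm n) d) N≡p^[1+a]*m)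
                                       (offMultiplesOf-divisorTerm pr p∤m (suc a) d)) (range 1 N)) ⟩
      sum (map (divisorTerm m) (range 1 N))
    ≡⟨ cong (sum ∘ map (divisorTerm m) ∘ range 1) (sym (m+[n∸m]≡n m≤N)) ⟩
      sum (map (divisorTerm m) (range 1 (m + (N ∸ m))))
    ≡⟨ sum-divisorTerm-beyond m (N ∸ m) ⟩
      σ m
    ∎

pred[p]*σ[p^a*m]+σ[m]≡p^[1+a]*σ[m] : ∀ {p} a {m} → Prime p → p ∤ m → .{{_ : NonZero m}} →
  pred p * σ (p ^ a * m) + σ m ≡ p ^ suc a * σ m
pred[p]*σ[p^a*m]+σ[m]≡p^[1+a]*σ[m] {p@(suc q)} zero {m} pr p∤m =
  trans (cong (λ n → q * σ n + σ m) (*-identityˡ m)) (q*s+s≡[1+q]*1*s q (σ m))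
  where
  q*s+s≡[1+q]*1*s : ∀ q s → q * s + s ≡ suc q * 1 * s
  q*s+s≡[1+q]*1*s = solve-∀
pred[p]*σ[p^a*m]+σ[m]≡p^[1+a]*σ[m] {p@(suc q)} (suc a) {m} pr p∤m = begin
    q * σ (p ^ suc a * m) + σ m
  ≡⟨ cong (λ n → q * σ n + σ m) (*-assoc p (p ^ a) m) ⟩
    q * σ (p * (p ^ a * m)) + σ m
  ≡⟨ cong (λ s → q * s + σ m) (σ[p*p^a*m]≡p*σ[p^a*m]+σ[m] a pr p∤m) ⟩
    q * (p * σ (p ^ a * m) + σ m) + σ m
  ≡⟨ regroup q (σ (p ^ a * m)) (σ m) ⟩
    p * (q * σ (p ^ a * m) + σ m)
  ≡⟨ cong (p *_) (pred[p]*σ[p^a*m]+σ[m]≡p^[1+a]*σ[m] a pr p∤m) ⟩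
    p * (p ^ suc a * σ m)
  ≡⟨ *-assoc p (p ^ suc a) (σ m) ⟨
    p ^ suc (suc a) * σ m
  ∎
  where
  open ≡-Reasoning
  regroup : ∀ q F s → q * (suc q * F + s) + s ≡ suc q * (q * F + s)
  regroup = solve-∀

-- The abundancy bound σ(N)/N ≤ ∏ p/(p-1)

prime≥2 : ∀ {p} → Prime p → 2 ≤ p
prime≥2 {p} pr = nonTrivial⇒n>1 p
  where open Prime pr

prime-power-decomposition : ∀ {p} → Prime p → ∀ N .{{_ : NonZero N}} →
  ∃[ a ] ∃[ m ] N ≡ p ^ a * m × p ∤ m
prime-power-decomposition {p} pr N = <-rec Decomposable decompose N
  where
  Decomposable : ℕ → Set
  Decomposable N = .{{_ : NonZero N}} → ∃[ a ] ∃[ m ] N ≡ p ^ a * m × p ∤ m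
  decompose : ∀ N → (∀ {M} → M < N → Decomposable M) → Decomposable N
  decompose N rec with p ∣? N
  ... | no  p∤N = 0 , N , sym (*-identityˡ N) , p∤N
  ... | yes (divides M refl) with rec {M} (m<m*n M p {{M≢0}} (prime≥2 pr)) {{M≢0}}
    where
    M≢0 : NonZero M
    M≢0 = m*n≢0⇒m≢0 M
  ...   | a , m , refl , p∤m =
    suc a , m , trans (*-comm (p ^ a * m) p) (sym (*-assoc p (p ^ a) m)) , p∤m

noPrimeDivisor⇒≡1 : ∀ N .{{_ : NonZero N}} → (∀ {r} → Prime r → ¬ r ∣ N) → N ≡ 1
noPrimeDivisor⇒≡1 N no-prime with factorise N
... | record { factors = [] ; isFactorisation = N≡1 } = N≡1
... | record { factors = r ∷ rs ; isFactorisation = N≡r*rs ; factorsPrime = r-prime ∷ _ } =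
  contradiction (divides (product rs) (trans N≡r*rs (*-comm r _))) (no-prime r-prime)

σ[N]*∏pred≤N*∏ : ∀ ps → All Prime ps →
  ∀ N .{{_ : NonZero N}} → (∀ {r} → Prime r → r ∣ N → r ∈ ps) →
  σ N * product (map pred ps) ≤ N * product ps
σ[N]*∏pred≤N*∏ [] [] N covered with noPrimeDivisor⇒≡1 N (λ pr r∣N → ¬Any[] (covered pr r∣N))
... | refl = ≤-refl
σ[N]*∏pred≤N*∏ (p ∷ ps) (p-prime ∷ ps-prime) N covered with prime-power-decomposition p-prime N
... | a , m , refl , p∤m = begin
    σ (p ^ a * m) * (pred p * D)
  ≡⟨ regroupˡ (σ (p ^ a * m)) (pred p) D ⟩
    (pred p * σ (p ^ a * m)) * D
  ≤⟨ *-monoˡ-≤ D p-part ⟩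
    (p * p ^ a * σ m) * D
  ≡⟨ *-assoc (p * p ^ a) (σ m) D ⟩
    p * p ^ a * (σ m * D)
  ≤⟨ *-monoʳ-≤ (p * p ^ a) (σ[N]*∏pred≤N*∏ ps ps-prime m covered′) ⟩
    p * p ^ a * (m * product ps)
  ≡⟨ regroupʳ p (p ^ a) m (product ps) ⟩
    p ^ a * m * (p * product ps)
  ∎
  where
  open ≤-Reasoning
  instance
    m≢0 : NonZero m
    m≢0 = m*n≢0⇒n≢0 (p ^ a)
  D = product (map pred ps)
  p-part : pred p * σ (p ^ a * m) ≤ p * p ^ a * σ m
  p-part = ≤-trans (m≤m+n _ (σ m)) (≤-reflexive (pred[p]*σ[p^a*m]+σ[m]≡p^[1+a]*σ[m] a p-prime p∤m))
  regroupˡ : ∀ s x d → s * (x * d) ≡ (x * s) * d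
  regroupˡ = solve-∀
  regroupʳ : ∀ p t m r → p * t * (m * r) ≡ t * m * (p * r)
  regroupʳ = solve-∀
  covered′ : ∀ {r} → Prime r → r ∣ m → r ∈ ps
  covered′ pr r∣m with covered pr (∣-trans r∣m (n∣m*n (p ^ a)))
  ... | here refl = contradiction r∣m p∤m
  ... | there r∈ps = r∈ps

-- Consecutive primes

searchPrime-≥ : ∀ f c → c ≤ searchPrime f c
searchPrime-≥ zero    c = ≤-refl
searchPrime-≥ (suc f) c with does (prime? c)
... | true  = ≤-refl
... | false = ≤-trans (n≤1+n c) (searchPrime-≥ f (suc c))

searchPrime-≤ : ∀ f c {q} → Prime q → c ≤ q → searchPrime f c ≤ q
searchPrime-≤ zero    c q-prime c≤q = c≤q
searchPrime-≤ (suc f) c {q} q-prime c≤q with prime? c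
... | yes _ = c≤q
... | no  c-composite with c ≟ q
...   | yes refl = contradiction q-prime c-composite
...   | no  c≢q  = searchPrime-≤ f (suc c) q-prime (≤∧≢⇒< c≤q c≢q)

P≥2 : ∀ j → 2 ≤ P j
P≥2 zero    = ≤-refl
P≥2 (suc j) = ≤-trans (P≥2 j) (≤-trans (n≤1+n _) (searchPrime-≥ (P j ! + 1) (suc (P j))))

P-next : ∀ j {q} → Prime q → P j < q → P (suc j) ≤ q
P-next j = searchPrime-≤ (P j ! + 1) (suc (P j))

data AscendingFrom : ℕ → List ℕ → Set where
  []  : ∀ {c} → AscendingFrom c []
  _∷_ : ∀ {c x xs} → c ≤ x → AscendingFrom (suc x) xs → AscendingFrom c (x ∷ xs)

AscendingFrom-weaken : ∀ {c c′ xs} → c ≤ c′ → AscendingFrom c′ xs → AscendingFrom c xs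
AscendingFrom-weaken c≤c′ []            = []
AscendingFrom-weaken c≤c′ (c′≤x ∷ rest) = ≤-trans c≤c′ c′≤x ∷ rest

AscendingFrom-filter-range : ∀ {P : ℕ → Set} (P? : Decidable P) c n → AscendingFrom c (filter P? (range c n))
AscendingFrom-filter-range P? c zero    = []
AscendingFrom-filter-range P? c (suc n) with does (P? c)
... | true  = ≤-refl ∷ AscendingFrom-filter-range P? (suc c) n
... | false = AscendingFrom-weaken (n≤1+n c) (AscendingFrom-filter-range P? (suc c) n)

n≤m⇒m*pred[n]≤n*pred[m] : ∀ {m n} → n ≤ m → m * pred n ≤ n * pred m
n≤m⇒m*pred[n]≤n*pred[m] {m} {zero}  _ = ≤-reflexive (*-zeroʳ m)
n≤m⇒m*pred[n]≤n*pred[m] {suc x} {suc y} (s≤s y≤x) = begin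
    y + x * y  ≤⟨ +-monoˡ-≤ (x * y) y≤x ⟩
    x + x * y  ≡⟨ cong (_+_ x) (*-comm x y) ⟩
    x + y * x  ∎
  where open ≤-Reasoning

ascending-primes-dominated : ∀ {c} j xs → AscendingFrom c xs → All Prime xs →
  (∀ {q} → Prime q → c ≤ q → P j ≤ q) →
  let Ps = map P (range j (length xs)) in
  product xs * product (map pred Ps) ≤ product Ps * product (map pred xs)
ascending-primes-dominated j []       []                 []                  _     = ≤-refl
ascending-primes-dominated j (x ∷ xs) (c≤x ∷ ascending) (x-prime ∷ primes) P-first = begin
    (x * X) * (pred (P j) * Y)
  ≡⟨ *-CS.interchange x X (pred (P j)) Y ⟩
    (x * pred (P j)) * (X * Y)
  ≤⟨ *-mono-≤ (n≤m⇒m*pred[n]≤n*pred[m] Pj≤x)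
              (ascending-primes-dominated (suc j) xs ascending primes
                 (λ q-prime x<q → P-next j q-prime (<-≤-trans (s≤s Pj≤x) x<q))) ⟩
    (P j * pred x) * (Z * W)
  ≡⟨ *-CS.interchange (P j) (pred x) Z W ⟩
    (P j * Z) * (pred x * W)
  ∎
  where
  open ≤-Reasoning
  Pj≤x = P-first x-prime c≤x
  Ps = map P (range (suc j) (length xs))
  X = product xs
  Y = product (map pred Ps)
  Z = product Ps
  W = product (map pred xs)

ratioProduct : List ℕ → ℚᵘ
ratioProduct xs = foldr Q._*_ 1ℚᵘ (map ratio xs)

prodRatio≡ratioProduct : ∀ j b → prodRatio j b ≡ ratioProduct (map P (range j b))
prodRatio≡ratioProduct j b = cong (foldr Q._*_ 1ℚᵘ) (begin
    map (ratio ∘ P ∘ (_+_ j)) (upTo b)          ≡⟨ map-∘ (upTo b) ⟩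
    map ratio (map (P ∘ (_+_ j)) (upTo b))      ≡⟨ cong (map ratio) (map-∘ (upTo b)) ⟩
    map ratio (map P (map (_+_ j) (upTo b)))    ≡⟨ cong (map ratio ∘ map P) (map-applyUpTo id (_+_ j) b) ⟩
    map ratio (map P (applyUpTo (_+_ j) b))
      ≡⟨ cong (map ratio ∘ map P) (applyUpTo-range (_+_ j) j b (λ _ → refl)) ⟩
    map ratio (map P (range j b))              ∎)
  where open ≡-Reasoning

↥ratioProduct : ∀ xs → Q.↥ ratioProduct xs ≡ + product xs
↥ratioProduct []       = refl
↥ratioProduct (x ∷ xs) =
  trans (↥-* (ratioProduct xs)) (trans (cong (+ x ℤ.*_) (↥ratioProduct xs)) (sym (pos-* x _)))
  where
  ↥-* : ∀ r → Q.↥ (ratio x Q.* r) ≡ + x ℤ.* Q.↥ r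
  ↥-* (mkℚᵘ _ _) = refl

↧ratioProduct : ∀ xs → All (2 ≤_) xs → Q.↧ₙ ratioProduct xs ≡ product (map pred xs)
↧ratioProduct []                     []                = refl
↧ratioProduct (suc zero ∷ _)         (s≤s () ∷ _)
↧ratioProduct (x@(suc (suc y)) ∷ xs) (_ ∷ xs≥2)    =
  trans (↧-* (ratioProduct xs)) (cong (suc y *_) (↧ratioProduct xs xs≥2))
  where
  ↧-* : ∀ r → Q.↧ₙ (ratio x Q.* r) ≡ suc y * Q.↧ₙ r
  ↧-* (mkℚᵘ _ _) = refl

16/15<ratioProduct : ∀ xs → All (2 ≤_) xs → 16 * product (map pred xs) < product xs * 15 →
  mkℚᵘ (+ 16) 14 Q.< ratioProduct xs
16/15<ratioProduct xs xs≥2 16*D<N*15 = *<* (subst₂ ℤ._<_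
  (trans (pos-* 16 (product (map pred xs))) (cong (λ d → + 16 ℤ.* + d) (sym (↧ratioProduct xs xs≥2))))
  (trans (pos-* (product xs) 15) (cong (ℤ._* + 15) (sym (↥ratioProduct xs))))
  (+<+ 16*D<N*15))

IsB-minimal : ∀ {α j b m} → IsB α j b → 1 ≤ m → α Q.< prodRatio j m → b ≤ m
IsB-minimal {b = b} {m} (_ , _ , below-b-fails) 1≤m α<prod with b ≤? m
... | yes b≤m = b≤m
... | no  b≰m = contradiction α<prod (below-b-fails m 1≤m (≰⇒> b≰m))

-- The two smallest prime divisors of an odd number

¬2∣odd-product : ∀ xs → All (2 ∤_) xs → 2 ∤ product xs
¬2∣odd-product []       []             2∣1  = contradiction (∣1⇒≡1 2∣1) (λ ())
¬2∣odd-product (x ∷ xs) (2∤x ∷ 2∤xs) 2∣x*xs with euclidsLemma x (product xs) prime[2] 2∣x*xs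
... | inj₁ 2∣x  = 2∤x 2∣x
... | inj₂ 2∣xs = ¬2∣odd-product xs 2∤xs 2∣xs

two-factors-bound : ∀ {p₁ p₂ D R} → 3 ≤ p₁ → 5 ≤ p₂ →
  2 * (pred p₁ * (pred p₂ * D)) ≤ p₁ * (p₂ * R) → 16 * D ≤ 15 * R
two-factors-bound {p₁} {p₂} {D} {R} 3≤p₁ 5≤p₂ h =
  *-cancelˡ-≤ (pred p₁ * pred p₂) {{m*n≢0 _ _ {{pred≢0 3≤p₁}} {{pred≢0 (≤-trans 3≤5 5≤p₂)}}}} (begin
    pred p₁ * pred p₂ * (16 * D)         ≡⟨ e₁ (pred p₁) (pred p₂) D ⟩
    8 * (2 * (pred p₁ * (pred p₂ * D)))  ≤⟨ *-monoʳ-≤ 8 h ⟩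
    8 * (p₁ * (p₂ * R))                  ≡⟨ e₂ p₁ p₂ R ⟩
    p₁ * 2 * (p₂ * 4) * R                ≤⟨ *-monoˡ-≤ R (*-mono-≤ (n≤m⇒m*pred[n]≤n*pred[m] 3≤p₁)
                                                              (n≤m⇒m*pred[n]≤n*pred[m] 5≤p₂)) ⟩
    3 * pred p₁ * (5 * pred p₂) * R      ≡⟨ e₃ (pred p₁) (pred p₂) R ⟩
    pred p₁ * pred p₂ * (15 * R)         ∎)
  where
  open ≤-Reasoning
  e₁ : ∀ a b D → a * b * (16 * D) ≡ 8 * (2 * (a * (b * D)))
  e₁ = solve-∀
  e₂ : ∀ p₁ p₂ R → 8 * (p₁ * (p₂ * R)) ≡ p₁ * 2 * (p₂ * 4) * R
  e₂ = solve-∀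
  e₃ : ∀ a b R → 3 * a * (5 * b) * R ≡ a * b * (15 * R)
  e₃ = solve-∀
  3≤5 : 3 ≤ 5
  3≤5 = s≤s (s≤s (s≤s z≤n))
  pred≢0 : ∀ {p} → 3 ≤ p → NonZero (pred p)
  pred≢0 3≤p = >-nonZero (≤-trans (s≤s z≤n) (pred-mono-≤ 3≤p))

beyond-two-smallest-bound : ∀ {N} A R → 2 ∤ N →
  length A ≡ 2 → AscendingFrom 0 A → All (λ p → Prime p × p ∣ N) A → All (_∣ N) R →
  2 * product (map pred (A ++ R)) ≤ product (A ++ R) →
  16 * product (map pred R) < 15 * product R
beyond-two-smallest-bound []                R _ () _ _ _ _
beyond-two-smallest-bound (_ ∷ [])          R _ () _ _ _ _
beyond-two-smallest-bound (_ ∷ _ ∷ _ ∷ _)   R _ () _ _ _ _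
beyond-two-smallest-bound {N} (p₁ ∷ p₂ ∷ []) R 2∤N _ (_ ∷ p₁<p₂ ∷ [])
                          ((p₁-prime , p₁∣N) ∷ (p₂-prime , p₂∣N) ∷ []) R∣N h =
  ≤∧≢⇒< (two-factors-bound {p₁} {p₂} {product (map pred R)} {product R} 3≤p₁ 5≤p₂ h) 16*D≢15*R
  where
  3≤p₁ : 3 ≤ p₁
  3≤p₁ = ≤∧≢⇒< (prime≥2 p₁-prime) (λ 2≡p₁ → 2∤N (subst (_∣ N) (sym 2≡p₁) p₁∣N))
  5≤p₂ : 5 ≤ p₂
  5≤p₂ = ≤∧≢⇒< (≤-trans (s≤s 3≤p₁) p₁<p₂)
                (λ 4≡p₂ → 2∤N (∣-trans (divides 2 refl) (subst (_∣ N) (sym 4≡p₂) p₂∣N)))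
  2∤R : 2 ∤ product R
  2∤R = ¬2∣odd-product R (All.map (λ r∣N 2∣r → 2∤N (∣-trans 2∣r r∣N)) R∣N)
  16*D≢15*R : 16 * product (map pred R) ≢ 15 * product R
  16*D≢15*R eq = [ from-no (2 ∣? 15) , 2∤R ]′
    (euclidsLemma 15 (product R) prime[2] (subst (2 ∣_) eq (∣-trans (divides 8 refl) (m∣m*n (product (map pred R))))))

16/15<-≤-trans : ∀ Rd Rn Cd Cn .{{_ : NonZero Cd}} → 16 * Rd < 15 * Rn → Rn * Cd ≤ Cn * Rd → 16 * Cd < Cn * 15
16/15<-≤-trans Rd Rn Cd Cn 16*Rd<15*Rn dominated = *-cancelˡ-< Rd (16 * Cd) (Cn * 15) (begin-strict
    Rd * (16 * Cd)   ≡⟨ e₁ Rd Cd ⟩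
    16 * Rd * Cd     <⟨ *-monoˡ-< Cd 16*Rd<15*Rn ⟩
    15 * Rn * Cd     ≡⟨ *-assoc 15 Rn Cd ⟩
    15 * (Rn * Cd)   ≤⟨ *-monoʳ-≤ 15 dominated ⟩
    15 * (Cn * Rd)   ≡⟨ e₂ Cn Rd ⟩
    Rd * (Cn * 15)   ∎)
  where
  open ≤-Reasoning
  e₁ : ∀ Rd Cd → Rd * (16 * Cd) ≡ 16 * Rd * Cd
  e₁ = solve-∀
  e₂ : ∀ Cn Rd → 15 * (Cn * Rd) ≡ Rd * (Cn * 15)
  e₂ = solve-∀

b≤length : ∀ {j b} R → IsB (mkℚᵘ (+ 16) 14) j b → AscendingFrom (P j) R → All Prime R →
  16 * product (map pred R) < 15 * product R → b ≤ length R
b≤length []          _   _         _      16<15     = contradiction 16<15 (<-asym (n<1+n 15))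
b≤length {j} R@(_ ∷ _) isB ascending primes 16*D<15*N =
  IsB-minimal {j = j} isB (s≤s z≤n) (subst (mkℚᵘ (+ 16) 14 Q.<_) (sym (prodRatio≡ratioProduct j (length R)))
    (16/15<ratioProduct Ps Ps≥2 (16/15<-≤-trans (product (map pred R)) (product R) _ (product Ps) 16*D<15*N dominated)))
  where
  Ps = map P (range j (length R))
  Ps≥2 : All (2 ≤_) Ps
  Ps≥2 = map⁺ (All.universal P≥2 (range j (length R)))
  dominated : product R * product (map pred Ps) ≤ product Ps * product (map pred R)
  dominated = ascending-primes-dominated j R ascending primes (λ _ Pj≤q → Pj≤q)
  instance
    ∏pred≢0 : NonZero (product (map pred Ps))
    ∏pred≢0 = product≢0 (map⁺ (All.map (λ 2≤x → >-nonZero (pred-mono-≤ 2≤x)) Ps≥2))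

primeDivisor? : ∀ N → Decidable (λ p → Prime p × p ∣ N)
primeDivisor? N p = prime? p ×-dec p ∣? N

primeDivisorsFrom : ℕ → ℕ → ℕ → List ℕ
primeDivisorsFrom N c n = filter (primeDivisor? N) (range c n)

primeDivisorsBelow-++ : ∀ N {c m} → c ≤ m →
  primeDivisorsBelow N m ≡ primeDivisorsBelow N c ++ primeDivisorsFrom N c (m ∸ c)
primeDivisorsBelow-++ N {c} {m} c≤m = begin
    filter Q? (upTo m)                              ≡⟨ cong (filter Q?) (upTo≡range m) ⟩
    filter Q? (range 0 m)                           ≡⟨ cong (filter Q? ∘ range 0) (m+[n∸m]≡n c≤m) ⟨
    filter Q? (range 0 (c + (m ∸ c)))               ≡⟨ cong (filter Q?) (range-++ 0 c (m ∸ c)) ⟩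
    filter Q? (range 0 c ++ range c (m ∸ c))        ≡⟨ filter-++ Q? (range 0 c) _ ⟩
    filter Q? (range 0 c) ++ primeDivisorsFrom N c (m ∸ c)
      ≡⟨ cong (λ xs → filter Q? xs ++ primeDivisorsFrom N c (m ∸ c)) (upTo≡range c) ⟨
    filter Q? (upTo c) ++ primeDivisorsFrom N c (m ∸ c) ∎
  where
  open ≡-Reasoning
  Q? = primeDivisor? N

primeDivisorsBelow-ascending : ∀ N m → AscendingFrom 0 (primeDivisorsBelow N m)
primeDivisorsBelow-ascending N m = subst (AscendingFrom 0 ∘ filter (primeDivisor? N)) (sym (upTo≡range m))
  (AscendingFrom-filter-range (primeDivisor? N) 0 m)

primeDivisorsBelow-complete : ∀ N .{{_ : NonZero N}} {r} → Prime r → r ∣ N → r ∈ primeDivisorsBelow N (suc N)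
primeDivisorsBelow-complete N r-prime r∣N =
  ∈-filter⁺ (primeDivisor? N) (∈-upTo⁺ (s≤s (∣⇒≤ r∣N))) (r-prime , r∣N)

abundant⇒2*∏pred≤∏ : ∀ N .{{_ : NonZero N}} → 2 * N ≤ σ N →
  2 * product (map pred (primeDivisorsBelow N (suc N))) ≤ product (primeDivisorsBelow N (suc N))
abundant⇒2*∏pred≤∏ N abundant = *-cancelʳ-≤ (2 * D) (product L) N (begin
    2 * D * N       ≡⟨ *-CS.xy∙z≈xz∙y 2 D N ⟩
    2 * N * D       ≤⟨ *-monoˡ-≤ D abundant ⟩
    σ N * D         ≤⟨ σ[N]*∏pred≤N*∏ L (All.map proj₁ (all-filter (primeDivisor? N) (upTo (suc N)))) N
                                   (primeDivisorsBelow-complete N) ⟩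
    N * product L   ≡⟨ *-comm N (product L) ⟩
    product L * N   ∎)
  where
  open ≤-Reasoning
  L = primeDivisorsBelow N (suc N)
  D = product (map pred L)

odd⇒nonZero : ∀ {N} → 2 ∤ N → NonZero N
odd⇒nonZero {zero}  2∤0 = contradiction (divides 0 refl) 2∤0
odd⇒nonZero {suc N} _   = _

proposition2 : (N p₃ j b : ℕ) → 2 ∤ N → σ N ≥ 2 * N → IsThirdPrimeDivisor N p₃ →
    p₃ ≡ P j → IsB (mkℚᵘ (+ 16) 14) j b → ω N ≥ b + 2
proposition2 N p₃ j b 2∤N abundant (_ , p₃∣N , two-below) refl isB = begin
    b + 2                 ≤⟨ +-monoˡ-≤ 2 (b≤length {j} R isB R-ascending (All.map proj₁ R-prime-divisors) tail) ⟩
    length R + 2          ≡⟨ +-comm (length R) 2 ⟩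
    2 + length R          ≡⟨ cong (_+ length R) two-below ⟨
    length A + length R   ≡⟨ length-++ A ⟨
    length (A ++ R)       ≡⟨ cong length split ⟨
    ω N                   ∎
  where
  open ≤-Reasoning
  instance
    N≢0 : NonZero N
    N≢0 = odd⇒nonZero 2∤N
  A = primeDivisorsBelow N (P j)
  r = suc N ∸ P j
  R = primeDivisorsFrom N (P j) r
  R-ascending : AscendingFrom (P j) R
  R-ascending = AscendingFrom-filter-range (primeDivisor? N) (P j) r
  R-prime-divisors : All (λ p → Prime p × p ∣ N) R
  R-prime-divisors = all-filter (primeDivisor? N) (range (P j) r)
  split : primeDivisorsBelow N (suc N) ≡ A ++ R
  split = primeDivisorsBelow-++ N (m≤n⇒m≤1+n (∣⇒≤ p₃∣N))
  tail : 16 * product (map pred R) < 15 * product R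
  tail = beyond-two-smallest-bound A R 2∤N two-below (primeDivisorsBelow-ascending N (P j))
           (all-filter (primeDivisor? N) (upTo (P j))) (All.map proj₂ R-prime-divisors)
           (subst (λ L → 2 * product (map pred L) ≤ product L) split (abundant⇒2*∏pred≤∏ N abundant))
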